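{- Let $r$ and $s$ be positive integers with $r \geq s \geq 2$. If $r > 3s - 3$, then $f(s,r,\{\infty\}\cup\mathbb{Z}) = 3s + 3r - 4$.
   Context: For integers $a\le b$, $[a,b]=\{n\in\mathbb{N} : a\le n\le b\}$. For a finite set $X\subseteq\mathbb{N}$, $\mathrm{diam}(X)=\max(X)-\min(X)$. Let $\infty$ denote an additional color not in $\mathbb{Z}$. For a coloring $\Delta:[1,n]\to\{\infty\}\cup\mathbb{Z}$, a set $Y$ is $\infty$-monochromatic if $\Delta(y)=\infty$ for all $y\in Y$, and is zero-sum mod $m$ if $\Delta(Y)\subseteq\mathbb{Z}$ and $\sum_{y\in Y}\Delta(y)\equiv 0\pmod m$. $f(s,r,\{\infty\}\cup\mathbb{Z})$ denotes the smallest positive integer $n$ such that for every coloring $\Delta:[1,n]\to\{\infty\}\cup\mathbb{Z}$ there exist subsets $S_1,S_2\subseteq[1,n]$ with: (a) $S_1$ is either $\infty$-monochromatic or zero-sum mod $s$, and $S_2$ is either $\infty$-monochromatic or zero-sum mod $r$; (b) $|S_1|=s$, $|S_2|=r$; (c) $\max(S_1)<\min(S_2)$; (d) $\mathrm{diam}(S_1)\le\mathrm{diam}(S_2)$. -}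

module Defs where

open import Data.Nat using (ℕ; zero; suc; _≤_; _<_)
open import Data.Integer using (ℤ; +_) renaming (_+_ to _+ℤ_)
open import Data.Integer.Divisibility using (_∣_)
open import Data.Fin using (Fin; zero; suc; fromℕ)
open import Data.Maybe using (Maybe; just; nothing)
open import Data.Product using (Σ; _×_; ∃-syntax)
open import Data.Sum using (_⊎_)
open import Relation.Binary.PropositionalEquality using (_≡_)
open import Relation.Nullary using (¬_)

-- Colors: {∞} ∪ ℤ, with `nothing` playing the role of ∞.
Color : Set
Color = Maybe ℤ

-- A coloring of [1,n]; only values on [1,n] are ever inspected.
Coloring : Set
Coloring = ℕ → Color

-- A subset of ℕ of size k, listed in strictly increasing order.
StrictlyIncreasing : {k : ℕ} → (Fin k → ℕ) → Set
StrictlyIncreasing {k} S = ∀ (i j : Fin k) → Data.Fin._<_ i j → S i < S j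

InRange : {k : ℕ} → ℕ → (Fin k → ℕ) → Set
InRange {k} n S = ∀ (i : Fin k) → (1 ≤ S i) × (S i ≤ n)

minS : {k : ℕ} → (Fin k → ℕ) → ℕ
minS {zero} S = 0
minS {suc k} S = S zero

maxS : {k : ℕ} → (Fin k → ℕ) → ℕ
maxS {zero} S = 0
maxS {suc k} S = S (fromℕ k)

diam : {k : ℕ} → (Fin k → ℕ) → ℕ
diam S = maxS S Data.Nat.∸ minS S

sumFin : {k : ℕ} → (Fin k → ℤ) → ℤ
sumFin {zero} c = + 0
sumFin {suc k} c = c zero +ℤ sumFin (λ i → c (suc i))

InfMono : {k : ℕ} → Coloring → (Fin k → ℕ) → Set
InfMono Δ S = ∀ i → Δ (S i) ≡ nothing

ZeroSumMod : {k : ℕ} → ℕ → Coloring → (Fin k → ℕ) → Set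
ZeroSumMod {k} m Δ S =
  Σ (Fin k → ℤ) λ c → (∀ i → Δ (S i) ≡ just (c i)) × ((+ m) ∣ sumFin c)

Good : {k : ℕ} → Coloring → (Fin k → ℕ) → Set
Good {k} Δ S = InfMono Δ S ⊎ ZeroSumMod k Δ S

Property : ℕ → ℕ → ℕ → Set
Property s r n =
  ∀ (Δ : Coloring) →
    ∃[ S₁ ] ∃[ S₂ ]
      ( StrictlyIncreasing {s} S₁ × InRange n S₁ × Good Δ S₁
      × StrictlyIncreasing {r} S₂ × InRange n S₂ × Good Δ S₂
      × maxS S₁ < minS S₂
      × diam S₁ ≤ diam S₂ )

IsF : ℕ → ℕ → ℕ → Set
IsF s r N = 1 ≤ N × Property s r N × (∀ n → 1 ≤ n → n < N → ¬ Property s r n)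

-- Upper bound: among 3k − 2 consecutive integers, either k are coloured ∞, or 2k − 1 carry
-- integers and the Erdős–Ginzburg–Ziv theorem picks k of them with sum ≡ 0 (mod k).  Taking S₁
-- in [1, 3s − 2] and S₂ in [3s − 1, 3s + 3r − 4] gives diam S₁ ≤ 3s − 3 ≤ r − 1 ≤ diam S₂.
-- Lower bound: colour [1, 3s − 3] by ∞^(s−1) 0^(s−1) 1^(s−1) and [3s − 1, 3s + 3r − 5] by
-- ∞^(r−1) 0^(r−1) 1^(r−1).  A zero-sum k-set of 0s and 1s is constant, so a good k-set is
-- monochromatic; no colour class of either range has k points; and if min S₂ ≤ 3s − 2 then
-- S₁ lies in the first range, otherwise S₂ lies in the second.
-- Erdős–Ginzburg–Ziv is proved for primes p by sorting the residues: either p of them coincide,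
-- or p − 1 pairs of distinct residues exist, and their sumset grows by one with each pair
-- (Cauchy–Davenport) until it covers ℤ/p.  It is multiplicative, so it holds for all n ≥ 1.
module Submission where

open import Defs
open import Data.Empty using (⊥)
open import Data.Fin as Fin using (Fin)
import Data.Fin.Properties as Fin
open import Data.Integer as ℤ using (ℤ; +_; _%ℕ_; _/ℕ_)
import Data.Integer.Divisibility as ℤ
import Data.Integer.Divisibility.Signed as ℤˢ
open import Data.Integer.DivMod using (a≡a%ℕn+[a/ℕn]*n)
import Data.Integer.Properties as ℤ
import Data.Integer.Tactic.RingSolver as ℤ-Solver
open import Data.List
  using (List; []; _∷_; _++_; length; map; concatMap; take; drop; filter; lookup; upTo; applyUpTo)
open import Data.List.Properties
  using (length-++; length-++-sucʳ; length-map; length-take; length-drop; length-upTo; length-applyUpTo;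
         map-++; concatMap-++; ++-assoc; take++drop≡id)
open import Data.List.Membership.Propositional using (_∈_)
open import Data.List.Membership.Propositional.Properties
  using (∈-∃++; ∈-map⁻; ∈-upTo⁺; ∈-upTo⁻; ∈-lookup)
open import Data.List.Relation.Binary.Permutation.Propositional
  as ↭ using (_↭_; ↭-refl; ↭-sym; ↭-trans; ↭-reflexive; prep; swap; ↭⇒↭ₛ)
open import Data.List.Relation.Binary.Permutation.Propositional.Properties
  using (shift; shifts; ++⁺; ++⁺ˡ; ++⁺ʳ; map⁺; ∈-resp-↭; ↭-length; All-resp-↭; ++-commutativeMonoid)
import Data.List.Relation.Binary.Permutation.Setoid.Properties as Permutationₛ
open import Data.List.Relation.Binary.Subset.Propositional using (_⊆_)
open import Data.List.Relation.Unary.All as All using (All; []; _∷_; all?)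
import Data.List.Relation.Unary.All.Properties as All
open import Data.List.Relation.Unary.All.Properties.Core using (¬Any⇒All¬; ¬All⇒Any¬)
open import Data.List.Relation.Unary.AllPairs as AllPairs using (AllPairs; []; _∷_)
import Data.List.Relation.Unary.AllPairs.Properties as AllPairs
import Data.List.Relation.Unary.Any as Any
open import Data.List.Relation.Unary.Any using (here; there)
open import Data.List.Relation.Unary.Linked as Linked using (_∷_)
import Data.List.Relation.Unary.Sorted.TotalOrder.Properties as Sorted
open import Data.List.Relation.Unary.Unique.Propositional using (Unique)
open import Data.List.Relation.Unary.Unique.Propositional.Properties using (upTo⁺)
open import Data.Maybe using (just; nothing; fromMaybe)
import Data.Maybe.Properties as Maybe
open import Data.Nat
  using (ℕ; zero; suc; _+_; _*_; _∸_; _≤_; _<_; _≟_; _≤?_; _<?_; z≤n; s≤s;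
         NonZero; >-nonZero⁻¹; ≢-nonZero⁻¹)
open import Data.List.Membership.DecPropositional _≟_ using (_∈?_)
open import Data.Nat.DivMod
  using (_%_; _/_; m≡m%n+[m/n]*n; %-distribˡ-+; m%n%n≡m%n; m%n<n; m<n⇒m%n≡m; n%n≡0; m*n%n≡0;
         %-remove-+ˡ; [m+n]%n≡m%n)
open import Data.Nat.Divisibility using (_∣_; divides; quotient; ∣⇒≤; *-pres-∣; ∣-refl; 1∣_; m%n≡0⇒n∣m)
open import Data.Nat.ListAction using (sum; product)
open import Data.Nat.ListAction.Properties using (sum-++; sum-↭)
open import Data.Nat.Primality using (Prime; euclidsLemma; prime⇒nonZero; productOfPrimes≢0)
open import Data.Nat.Primality.Factorisation using (factorise; PrimeFactorisation)
open import Data.Nat.Properties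
open import Data.Nat.Tactic.RingSolver using (solve-∀)
open import Data.Product using (∃₂; ∃-syntax; _×_; _,_; proj₁; proj₂)
open import Data.Sum using (_⊎_; inj₁; inj₂)
open import Function using (_∘_)
open import Relation.Binary.Bundles using (DecTotalOrder)
import Relation.Binary.Construct.On as On
open import Relation.Binary.PropositionalEquality
open import Relation.Nullary using (¬_; Dec; yes; no; ¬?; contradiction)
open import Relation.Unary using (Decidable)

module _ {A : Set} where

  unique-⊆⇒length≤ : {xs ys : List A} → Unique xs → xs ⊆ ys → length xs ≤ length ys
  unique-⊆⇒length≤ {[]} _ _ = z≤n
  unique-⊆⇒length≤ {x ∷ xs} (x∉xs ∷ xs-unique) xs⊆ys with ∈-∃++ (xs⊆ys (here refl))
  ... | ys₁ , ys₂ , refl = begin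
    suc (length xs)           ≤⟨ s≤s (unique-⊆⇒length≤ xs-unique xs⊆ys₁++ys₂) ⟩
    suc (length (ys₁ ++ ys₂)) ≡⟨ length-++-sucʳ ys₁ x ys₂ ⟨
    length (ys₁ ++ x ∷ ys₂)   ∎
    where
    open ≤-Reasoning
    xs⊆ys₁++ys₂ : xs ⊆ ys₁ ++ ys₂
    xs⊆ys₁++ys₂ z∈xs with ∈-resp-↭ (shift x ys₁ ys₂) (xs⊆ys (there z∈xs))
    ... | here z≡x = contradiction (sym z≡x) (All.lookup x∉xs z∈xs)
    ... | there z∈ys₁++ys₂ = z∈ys₁++ys₂

  concatMap⁺ : {B : Set} (f : B → List A) {xs ys : List B} → xs ↭ ys → concatMap f xs ↭ concatMap f ys
  concatMap⁺ f ↭.refl = ↭-refl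
  concatMap⁺ f (prep x p) = ++⁺ˡ (f x) (concatMap⁺ f p)
  concatMap⁺ f (swap x y p) = ↭-trans (shifts (f x) (f y)) (++⁺ˡ (f y) (++⁺ˡ (f x) (concatMap⁺ f p)))
  concatMap⁺ f (↭.trans p q) = ↭-trans (concatMap⁺ f p) (concatMap⁺ f q)

  Unique-map⁺-on : {B : Set} {P : A → Set} {f : A → B} → (∀ {x y} → P x → P y → f x ≡ f y → x ≡ y) →
    {xs : List A} → All P xs → Unique xs → Unique (map f xs)
  Unique-map⁺-on f-inj [] [] = []
  Unique-map⁺-on f-inj (px ∷ pxs) (x∉xs ∷ xs-unique) =
    All.map⁺ (All.zipWith (λ (py , x≢y) fx≡fy → x≢y (f-inj px py fx≡fy)) (pxs , x∉xs)) ∷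
    Unique-map⁺-on f-inj pxs xs-unique

  AllPairs-++⁻ˡ : {R : A → A → Set} (xs : List A) {ys : List A} → AllPairs R (xs ++ ys) → AllPairs R xs
  AllPairs-++⁻ˡ [] _ = []
  AllPairs-++⁻ˡ (x ∷ xs) (x~ ∷ xs~) = All.++⁻ˡ xs x~ ∷ AllPairs-++⁻ˡ xs xs~

  length-filter-¬ : {P : A → Set} (P? : Decidable P) (xs : List A) →
    length (filter P? xs) + length (filter (¬? ∘ P?) xs) ≡ length xs
  length-filter-¬ P? [] = refl
  length-filter-¬ P? (x ∷ xs) with P? x
  ... | yes _ = cong suc (length-filter-¬ P? xs)
  ... | no _ = trans (+-suc _ _) (cong suc (length-filter-¬ P? xs))

-- Residues modulo p

module _ (p : ℕ) .{{_ : NonZero p}} where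

  %-congʳ-+ : ∀ m {n o} → n % p ≡ o % p → (m + n) % p ≡ (m + o) % p
  %-congʳ-+ m {n} {o} eq = begin
    (m + n) % p           ≡⟨ %-distribˡ-+ m n p ⟩
    (m % p + n % p) % p   ≡⟨ cong (λ k → (m % p + k) % p) eq ⟩
    (m % p + o % p) % p   ≡⟨ %-distribˡ-+ m o p ⟨
    (m + o) % p           ∎
    where open ≡-Reasoning

  %-congˡ-+ : ∀ {m n} o → m % p ≡ n % p → (m + o) % p ≡ (n + o) % p
  %-congˡ-+ {m} {n} o eq = begin
    (m + o) % p   ≡⟨ cong (_% p) (+-comm m o) ⟩
    (o + m) % p   ≡⟨ %-congʳ-+ o eq ⟩
    (o + n) % p   ≡⟨ cong (_% p) (+-comm o n) ⟩
    (n + o) % p   ∎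
    where open ≡-Reasoning

  %-≡⇒∣∸ : ∀ {m n} → m % p ≡ n % p → p ∣ n ∸ m
  %-≡⇒∣∸ {m} {n} eq = divides (n / p ∸ m / p) (begin
    n ∸ m                                      ≡⟨ cong₂ _∸_ (m≡m%n+[m/n]*n n p) (m≡m%n+[m/n]*n m p) ⟩
    (n % p + n / p * p) ∸ (m % p + m / p * p)  ≡⟨ cong (λ r → (n % p + n / p * p) ∸ (r + m / p * p)) eq ⟩
    (n % p + n / p * p) ∸ (n % p + m / p * p)  ≡⟨ [m+n]∸[m+o]≡n∸o (n % p) _ _ ⟩
    n / p * p ∸ m / p * p                      ≡⟨ *-distribʳ-∸ p (n / p) (m / p) ⟨
    (n / p ∸ m / p) * p                        ∎)
    where open ≡-Reasoning

  ∣∸⇒≤ : ∀ {m n} → p ∣ n ∸ m → n < p → n ≤ m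
  ∣∸⇒≤ {m} {n} p∣n∸m n<p with n ∸ m in eq
  ... | zero = m∸n≡0⇒m≤n eq
  ... | suc _ = contradiction (∣⇒≤ p∣n∸m)
    (<⇒≱ (≤-<-trans (≤-trans (≤-reflexive (sym eq)) (m∸n≤m n m)) n<p))

  ∣∸⇒injective : {f : ℕ → ℕ} → (∀ {i j} → f i ≡ f j → p ∣ j ∸ i) →
    ∀ {i j} → i < p → j < p → f i ≡ f j → i ≡ j
  ∣∸⇒injective f-gap i<p j<p fi≡fj =
    ≤-antisym (∣∸⇒≤ (f-gap (sym fi≡fj)) i<p) (∣∸⇒≤ (f-gap fi≡fj) j<p)

  translate-gap : ∀ c {i j} → (c + i) % p ≡ (c + j) % p → p ∣ j ∸ i
  translate-gap c {i} {j} eq = subst (p ∣_) ([m+n]∸[m+o]≡n∸o c j i) (%-≡⇒∣∸ eq)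

  residues-complete : ∀ {U} → Unique U → All (_< p) U → p ≤ length U → ∀ {t} → t < p → t ∈ U
  residues-complete {U} U-unique U<p p≤|U| {t} t<p with t ∈? U
  ... | yes t∈U = t∈U
  ... | no t∉U = contradiction p≤|U| (<⇒≱ (subst (suc (length U) ≤_) (length-upTo p)
                   (unique-⊆⇒length≤ (¬Any⇒All¬ U t∉U ∷ U-unique) t∷U⊆upTo-p)))
    where
    t∷U⊆upTo-p : t ∷ U ⊆ upTo p
    t∷U⊆upTo-p (here refl) = ∈-upTo⁺ t<p
    t∷U⊆upTo-p (there u∈U) = ∈-upTo⁺ (All.lookup U<p u∈U)

module _ {p : ℕ} (p-prime : Prime p) where

  private instance
    p≢0 : NonZero p
    p≢0 = prime⇒nonZero p-prime

  orbit-gap : ∀ u {δ i j} → ¬ p ∣ δ → (u + i * δ) % p ≡ (u + j * δ) % p → p ∣ j ∸ i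
  orbit-gap u {δ} {i} {j} p∤δ eq with euclidsLemma (j ∸ i) δ p-prime (subst (p ∣_) gap≡ (%-≡⇒∣∸ p eq))
    where
    gap≡ : u + j * δ ∸ (u + i * δ) ≡ (j ∸ i) * δ
    gap≡ = trans ([m+n]∸[m+o]≡n∸o u (j * δ) (i * δ)) (sym (*-distribʳ-∸ δ j i))
  ... | inj₁ p∣j∸i = p∣j∸i
  ... | inj₂ p∣δ = contradiction p∣δ p∤δ

  closed⇒p≤length : ∀ {δ U} → ¬ p ∣ δ → (∀ {u} → u ∈ U → (δ + u) % p ∈ U) →
    All (_< p) U → 0 < length U → p ≤ length U
  closed⇒p≤length {δ} {U@(u₀ ∷ _)} p∤δ closed (u₀<p ∷ _) _ = begin
    p                              ≡⟨ trans (length-map orbit (upTo p)) (length-upTo p) ⟨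
    length (map orbit (upTo p))    ≤⟨ unique-⊆⇒length≤ orbit-unique orbit⊆U ⟩
    length U                       ∎
    where
    open ≤-Reasoning
    orbit : ℕ → ℕ
    orbit i = (u₀ + i * δ) % p
    orbit-∈ : ∀ i → orbit i ∈ U
    orbit-∈ zero = subst (_∈ U) (sym (trans (cong (_% p) (+-identityʳ u₀)) (m<n⇒m%n≡m u₀<p))) (here refl)
    orbit-∈ (suc i) =
      subst (_∈ U) (trans (%-congʳ-+ p δ (m%n%n≡m%n _ p)) (cong (_% p) (step u₀ i δ))) (closed (orbit-∈ i))
      where
      step : ∀ u i δ → δ + (u + i * δ) ≡ u + suc i * δ
      step = solve-∀
    orbit⊆U : map orbit (upTo p) ⊆ U
    orbit⊆U o∈ with ∈-map⁻ orbit o∈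
    ... | i , _ , refl = orbit-∈ i
    orbit-unique : Unique (map orbit (upTo p))
    orbit-unique = Unique-map⁺-on (∣∸⇒injective p (λ {i} {j} → orbit-gap u₀ {δ} {i} {j} p∤δ))
      (All.tabulate ∈-upTo⁻) (upTo⁺ p)

-- The Erdős–Ginzburg–Ziv theorem

ErdősGinzburgZiv : ℕ → Set₁
ErdősGinzburgZiv n = ∀ {A : Set} (w : A → ℕ) (L : List A) → n + n ≤ suc (length L) →
  ∃₂ λ T R → L ↭ T ++ R × length T ≡ n × n ∣ sum (map w T)

ErdősGinzburgZiv-1 : ErdősGinzburgZiv 1
ErdősGinzburgZiv-1 w [] (s≤s ())
ErdősGinzburgZiv-1 w (x ∷ L) _ = x ∷ [] , L , ↭-refl , refl , 1∣ _

record Block {A : Set} (w : A → ℕ) (a : ℕ) : Set where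
  field
    elems : List A
    length-elems : length elems ≡ a
    divisible : a ∣ sum (map w elems)

open Block

module _ {A : Set} {w : A → ℕ} {a : ℕ} where

  weight : Block w a → ℕ
  weight B = quotient (divisible B)

  length-concat-blocks : ∀ (Bs : List (Block w a)) → length (concatMap elems Bs) ≡ length Bs * a
  length-concat-blocks [] = refl
  length-concat-blocks (B ∷ Bs) = trans (length-++ (elems B)) (cong₂ _+_ (length-elems B) (length-concat-blocks Bs))

  sum-concat-blocks : ∀ Bs → sum (map w (concatMap elems Bs)) ≡ sum (map weight Bs) * a
  sum-concat-blocks [] = refl
  sum-concat-blocks (B ∷ Bs) = begin
    sum (map w (elems B ++ concatMap elems Bs))               ≡⟨ cong sum (map-++ w (elems B) _) ⟩
    sum (map w (elems B) ++ map w (concatMap elems Bs))       ≡⟨ sum-++ (map w (elems B)) _ ⟩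
    sum (map w (elems B)) + sum (map w (concatMap elems Bs))  ≡⟨ cong₂ _+_ (_∣_.equality (divisible B)) (sum-concat-blocks Bs) ⟩
    weight B * a + sum (map weight Bs) * a                    ≡⟨ *-distribʳ-+ a (weight B) _ ⟨
    sum (map weight (B ∷ Bs)) * a                             ∎
    where open ≡-Reasoning

module _ {a : ℕ} (egz-a : ErdősGinzburgZiv a) {A : Set} (w : A → ℕ) where

  extract-blocks : ∀ j (L : List A) → j * a + a ≤ suc (length L) →
    ∃₂ λ (Bs : List (Block w a)) R → L ↭ concatMap elems Bs ++ R × length Bs ≡ j
  extract-blocks zero L _ = [] , L , ↭-refl , refl
  extract-blocks (suc j) L bound with egz-a w L (≤-trans (+-monoˡ-≤ a (m≤m+n a (j * a))) bound)
  ... | T , R₁ , L↭T++R₁ , |T|≡a , a∣ΣT with extract-blocks j R₁ bound′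
    where
    bound′ : j * a + a ≤ suc (length R₁)
    bound′ = +-cancelˡ-≤ a _ _ (begin
      a + (j * a + a)          ≡⟨ +-assoc a (j * a) a ⟨
      suc j * a + a            ≤⟨ bound ⟩
      suc (length L)           ≡⟨ cong suc (↭-length L↭T++R₁) ⟩
      suc (length (T ++ R₁))   ≡⟨ cong suc (trans (length-++ T) (cong (_+ length R₁) |T|≡a)) ⟩
      suc (a + length R₁)      ≡⟨ +-suc a (length R₁) ⟨
      a + suc (length R₁)      ∎)
      where open ≤-Reasoning
  ... | Bs , R , R₁↭Bs++R , |Bs|≡j =
    record { elems = T ; length-elems = |T|≡a ; divisible = a∣ΣT } ∷ Bs , R ,
    ↭-trans L↭T++R₁ (↭-trans (++⁺ˡ T R₁↭Bs++R) (↭-reflexive (sym (++-assoc T _ R)))) ,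
    cong suc |Bs|≡j

-- Extract 2b − 1 blocks of a elements with sums divisible by a, then apply EGZ for b to the quotients.
ErdősGinzburgZiv-* : ∀ {a b} → ErdősGinzburgZiv a → ErdősGinzburgZiv b → .{{NonZero b}} →
  ErdősGinzburgZiv (a * b)
ErdősGinzburgZiv-* {a} {suc b′} egz-a egz-b w L bound
  with extract-blocks egz-a w (b′ + suc b′) L (subst (_≤ suc (length L)) (blocks-needed a b′) bound)
  where
  blocks-needed : ∀ a b′ → a * suc b′ + a * suc b′ ≡ (b′ + suc b′) * a + a
  blocks-needed = solve-∀
... | Bs , R , L↭Bs++R , |Bs|≡2b-1 with egz-b weight Bs (≤-reflexive (cong suc (sym |Bs|≡2b-1)))
... | C , D , Bs↭C++D , |C|≡b , b∣ΣC =
  concatMap elems C , concatMap elems D ++ R , L↭ ,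
  trans (length-concat-blocks C) (trans (cong (_* a) |C|≡b) (*-comm (suc b′) a)) ,
  subst₂ _∣_ (*-comm (suc b′) a) (sym (sum-concat-blocks C)) (*-pres-∣ b∣ΣC (∣-refl {a}))
  where
  L↭ : L ↭ concatMap elems C ++ concatMap elems D ++ R
  L↭ = ↭-trans L↭Bs++R (↭-trans (++⁺ʳ R (concatMap⁺ elems Bs↭C++D))
         (↭-reflexive (trans (cong (_++ R) (concatMap-++ elems C D)) (++-assoc (concatMap elems C) _ R))))

module _ {A : Set} where

  flatten : List (A × A) → List A
  flatten = concatMap λ (x , y) → x ∷ y ∷ []

  flatten-↭ : ∀ P → flatten P ↭ map proj₁ P ++ map proj₂ P
  flatten-↭ [] = ↭-refl
  flatten-↭ ((x , y) ∷ P) =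
    prep x (↭-trans (prep y (flatten-↭ P)) (↭-sym (shift y (map proj₁ P) (map proj₂ P))))

module _ {A : Set} (key : A → ℕ) where

  private
    keyOrder : DecTotalOrder _ _ _
    keyOrder = On.decTotalOrder ≤-decTotalOrder key

  open import Data.List.Sort keyOrder using (sort; sort-↭; sort-↗)
  open import Data.List.Relation.Unary.Sorted.TotalOrder (DecTotalOrder.totalOrder keyOrder) using (Sorted)
  open import Algebra.Solver.CommutativeMonoid (++-commutativeMonoid {A = A}) using (solve; _⊜_; _⊕_)

  Distinct : List (A × A) → Set
  Distinct = All λ (x , y) → key x ≢ key y

  data WindowOrPairs (q : ℕ) (L : List A) : Set where
    window : ∀ f W R → L ↭ W ++ R → length W ≡ suc q → All (λ x → key x ≡ key f) W → WindowOrPairs q L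
    pairs : ∀ P z R → L ↭ flatten P ++ z ∷ R → length P ≡ q → Distinct P → WindowOrPairs q L

  WindowOrPairs-resp-↭ : ∀ {q L L′} → L ↭ L′ → WindowOrPairs q L′ → WindowOrPairs q L
  WindowOrPairs-resp-↭ L↭L′ (window f W R L′↭ |W|≡ const) = window f W R (↭-trans L↭L′ L′↭) |W|≡ const
  WindowOrPairs-resp-↭ L↭L′ (pairs P z R L′↭ |P|≡ distinct) = pairs P z R (↭-trans L↭L′ L′↭) |P|≡ distinct

  window-constant : ∀ {f} M {g G} → Sorted (f ∷ M ++ g ∷ G) → key g ≤ key f →
    All (λ x → key x ≡ key f) (M ++ g ∷ [])
  window-constant [] (f≤g ∷ _) g≤f = ≤-antisym g≤f f≤g ∷ []
  window-constant {f} (m ∷ M) {g} (f≤m ∷ sorted) g≤f = m≡f ∷ All.map (λ x≡m → trans x≡m m≡f) rest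
    where
    rest : All (λ x → key x ≡ key m) (M ++ g ∷ [])
    rest = window-constant M sorted (≤-trans g≤f f≤m)
    m≡f : key m ≡ key f
    m≡f = ≤-antisym (≤-trans (≤-reflexive (sym (All.head (All.++⁻ʳ M rest)))) g≤f) f≤m

  -- f and g are the i-th and (i + q)-th smallest elements; the g's paired so far, map proj₂ P,
  -- lie between F and G in the sorted order, so a window from f to g has q + 1 elements.
  scan : ∀ {q} P F G → Sorted (F ++ map proj₂ P ++ G) → length P + length F ≡ q → length F < length G →
    Distinct P → WindowOrPairs q (flatten P ++ F ++ G)
  scan P [] (z ∷ R) _ size _ distinct = pairs P z R ↭-refl (trans (sym (+-identityʳ (length P))) size) distinct
  scan {q} P (f ∷ F) (g ∷ G) sorted size (s≤s |F|<|G|) distinct with key f ≟ key g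
  ... | yes f≡g = window f (f ∷ (F ++ D) ++ g ∷ []) (map proj₁ P ++ G) L↭W++R |W|≡ (refl ∷ const)
    where
    D = map proj₂ P
    L↭W++R : flatten P ++ f ∷ F ++ g ∷ G ↭ (f ∷ (F ++ D) ++ g ∷ []) ++ map proj₁ P ++ G
    L↭W++R = ↭-trans (++⁺ʳ (f ∷ F ++ g ∷ G) (flatten-↭ P))
      (solve 6 (λ E D f F g G → (E ⊕ D) ⊕ ((f ⊕ F) ⊕ (g ⊕ G)) ⊜ ((f ⊕ (F ⊕ D)) ⊕ g) ⊕ (E ⊕ G)) ↭-refl
        (map proj₁ P) D (f ∷ []) F (g ∷ []) G)
    |W|≡ : length (f ∷ (F ++ D) ++ g ∷ []) ≡ suc q
    |W|≡ = begin
      suc (length ((F ++ D) ++ g ∷ []))  ≡⟨ cong suc (trans (length-++ (F ++ D)) (cong (_+ 1) (length-++ F))) ⟩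
      suc (length F + length D + 1)      ≡⟨ cong (λ d → suc (length F + d + 1)) (length-map proj₂ P) ⟩
      suc (length F + length P + 1)      ≡⟨ cong suc (regroup (length F) (length P)) ⟩
      suc (length P + suc (length F))    ≡⟨ cong suc size ⟩
      suc q                              ∎
      where
      open ≡-Reasoning
      regroup : ∀ f p → f + p + 1 ≡ p + suc f
      regroup = solve-∀
    const : All (λ x → key x ≡ key f) ((F ++ D) ++ g ∷ [])
    const = window-constant (F ++ D) (subst (λ xs → Sorted (f ∷ xs)) (sym (++-assoc F D (g ∷ G))) sorted)
      (≤-reflexive (sym f≡g))
  ... | no f≢g = WindowOrPairs-resp-↭ L↭L′
          (scan (P ++ (f , g) ∷ []) F G sorted′ size′ |F|<|G| (All.++⁺ distinct (f≢g ∷ [])))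
    where
    L↭L′ : flatten P ++ f ∷ F ++ g ∷ G ↭ flatten (P ++ (f , g) ∷ []) ++ F ++ G
    L↭L′ = ↭-trans
      (solve 5 (λ E f F g G → E ⊕ ((f ⊕ F) ⊕ (g ⊕ G)) ⊜ (E ⊕ (f ⊕ g)) ⊕ (F ⊕ G)) ↭-refl
        (flatten P) (f ∷ []) F (g ∷ []) G)
      (↭-reflexive (cong (_++ F ++ G) (sym (concatMap-++ _ P ((f , g) ∷ [])))))
    sorted′ : Sorted (F ++ map proj₂ (P ++ (f , g) ∷ []) ++ G)
    sorted′ = subst (λ xs → Sorted (F ++ xs))
      (trans (sym (++-assoc (map proj₂ P) (g ∷ []) G)) (cong (_++ G) (sym (map-++ proj₂ P _))))
      (Linked.tail sorted)
    size′ : length (P ++ (f , g) ∷ []) + length F ≡ q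
    size′ = trans (cong (_+ length F) (length-++ P)) (trans (+-assoc (length P) 1 (length F)) size)

  window-or-pairs : ∀ q (L : List A) → q + suc q ≤ length L → WindowOrPairs q L
  window-or-pairs q L bound = WindowOrPairs-resp-↭ (↭-trans (↭-sym (sort-↭ L)) (↭-reflexive ys≡F++G))
    (scan [] F G sorted |F|≡q |F|<|G| [])
    where
    ys F G : List A
    ys = sort L
    F = take q ys
    G = drop q ys
    ys≡F++G : ys ≡ F ++ G
    ys≡F++G = sym (take++drop≡id q ys)
    sorted : Sorted (F ++ G)
    sorted = subst Sorted ys≡F++G (sort-↗ L)
    bound′ : q + suc q ≤ length ys
    bound′ = subst (q + suc q ≤_) (sym (↭-length (sort-↭ L))) bound
    |F|≡q : length F ≡ q
    |F|≡q = trans (length-take q ys) (m≤n⇒m⊓n≡m (m+n≤o⇒m≤o q bound′))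
    |F|<|G| : length F < length G
    |F|<|G| = begin-strict
      length F        ≡⟨ |F|≡q ⟩
      q               <⟨ n<1+n q ⟩
      suc q           ≤⟨ m+n≤o⇒m≤o∸n (suc q) (subst (_≤ length ys) (+-comm q (suc q)) bound′) ⟩
      length ys ∸ q   ≡⟨ length-drop q ys ⟨
      length G        ∎
      where open ≤-Reasoning

module _ {p : ℕ} (p-prime : Prime p) {A : Set} (w : A → ℕ) where

  private instance
    p≢0 : NonZero p
    p≢0 = prime⇒nonZero p-prime

  residue : A → ℕ
  residue x = w x % p

  record Attains (P : List (A × A)) (v : ℕ) : Set where
    constructor attains
    field
      chosen rest : List A
      split : flatten P ↭ chosen ++ rest
      length-chosen : length chosen ≡ length P
      residue-sum : sum (map w chosen) % p ≡ v

  attains-∷ : ∀ {P v x y x′ y′} → x ∷ y ∷ [] ↭ x′ ∷ y′ ∷ [] → Attains P v →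
    Attains ((x , y) ∷ P) ((w x′ + v) % p)
  attains-∷ {P} {v} {x} {y} {x′} {y′} xy↭ (attains C N split |C|≡ Σ≡) =
    attains (x′ ∷ C) (y′ ∷ N) split′ (cong suc |C|≡)
      (%-congʳ-+ p (w x′) (trans (sym (m%n%n≡m%n _ p)) (cong (_% p) Σ≡)))
    where
    split′ : flatten ((x , y) ∷ P) ↭ x′ ∷ C ++ y′ ∷ N
    split′ = ↭-trans (++⁺ xy↭ split) (prep x′ (↭-sym (shift y′ C N)))

  record SumSet (P : List (A × A)) : Set where
    field
      residues : List ℕ
      unique : Unique residues
      bounded : All (_< p) residues
      attained : All (Attains P) residues
      large : suc (length P) ≤ length residues

  sumset-[] : SumSet []
  sumset-[] = record
    { residues = 0 ∷ []
    ; unique = [] ∷ []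
    ; bounded = 0<p ∷ []
    ; attained = attains [] [] ↭-refl refl (m<n⇒m%n≡m 0<p) ∷ []
    ; large = ≤-refl
    }
    where
    0<p : 0 < p
    0<p = >-nonZero⁻¹ p

  -- gap x y ≡ w y - w x (mod p), kept in ℕ.
  gap : A → A → ℕ
  gap x y = residue y + (p ∸ residue x)

  gap-+ : ∀ x y → (gap x y + w x) % p ≡ w y % p
  gap-+ x y = begin
    (gap x y + w x) % p        ≡⟨ %-congʳ-+ p (gap x y) (m%n%n≡m%n (w x) p) ⟨
    (gap x y + residue x) % p  ≡⟨ cong (_% p) (trans (+-assoc (residue y) _ _)
                                    (cong (λ n → residue y + n) (m∸n+n≡m (<⇒≤ (m%n<n (w x) p))))) ⟩
    (residue y + p) % p        ≡⟨ [m+n]%n≡m%n (residue y) p ⟩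
    residue y % p              ≡⟨ m%n%n≡m%n (w y) p ⟩
    w y % p                    ∎
    where open ≡-Reasoning

  gap-translate : ∀ x y v → (gap x y + (w x + v) % p) % p ≡ (w y + v) % p
  gap-translate x y v = begin
    (gap x y + (w x + v) % p) % p  ≡⟨ %-congʳ-+ p (gap x y) (m%n%n≡m%n (w x + v) p) ⟩
    (gap x y + (w x + v)) % p      ≡⟨ cong (_% p) (+-assoc (gap x y) (w x) v) ⟨
    (gap x y + w x + v) % p        ≡⟨ %-congˡ-+ p v (gap-+ x y) ⟩
    (w y + v) % p                  ∎
    where open ≡-Reasoning

  gap-nondivisible : ∀ {x y} → residue x ≢ residue y → ¬ p ∣ gap x y
  gap-nondivisible {x} {y} x≢y p∣gap = x≢y (trans (sym (%-remove-+ˡ (w x) p∣gap)) (gap-+ x y))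

  -- Either translating U by w y leaves U + w x, which gives a new residue, or U + w x is closed
  -- under adding gap x y ≢ 0 and hence has p elements.
  sumset-∷ : ∀ {P x y} → residue x ≢ residue y → suc (suc (length P)) ≤ p → SumSet P →
    SumSet ((x , y) ∷ P)
  sumset-∷ {P} {x} {y} x≢y bound S = extend (all? (λ v → (w y + v) % p ∈? U′) U)
    where
    open SumSet S renaming (residues to U)
    U′ : List ℕ
    U′ = map (λ v → (w x + v) % p) U
    U′-unique : Unique U′
    U′-unique = Unique-map⁺-on (∣∸⇒injective p (translate-gap p (w x))) bounded unique
    U′-bounded : All (_< p) U′
    U′-bounded = All.map⁺ (All.tabulate (λ _ → m%n<n _ p))
    U′-attained : All (Attains ((x , y) ∷ P)) U′
    U′-attained = All.map⁺ (All.map (attains-∷ ↭-refl) attained)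
    |U′|≡|U| : length U′ ≡ length U
    |U′|≡|U| = length-map _ U
    extend : Dec (All (λ v → (w y + v) % p ∈ U′) U) → SumSet ((x , y) ∷ P)
    extend (yes closed) = record
      { residues = U′
      ; unique = U′-unique
      ; bounded = U′-bounded
      ; attained = U′-attained
      ; large = ≤-trans bound
          (closed⇒p≤length p-prime (gap-nondivisible x≢y) U′-closed U′-bounded U′-nonempty)
      }
      where
      U′-closed : ∀ {u} → u ∈ U′ → (gap x y + u) % p ∈ U′
      U′-closed u∈U′ with ∈-map⁻ _ u∈U′
      ... | v , v∈U , refl = subst (_∈ U′) (sym (gap-translate x y v)) (All.lookup closed v∈U)
      U′-nonempty : 0 < length U′
      U′-nonempty = ≤-trans (s≤s z≤n) (subst (suc (length P) ≤_) (sym |U′|≡|U|) large)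
    extend (no ¬closed) = record
      { residues = (w y + v) % p ∷ U′
      ; unique = ¬Any⇒All¬ U′ (proj₂ found) ∷ U′-unique
      ; bounded = m%n<n _ p ∷ U′-bounded
      ; attained = attains-∷ (swap x y ↭-refl) (proj₁ found) ∷ U′-attained
      ; large = s≤s (subst (suc (length P) ≤_) (sym |U′|≡|U|) large)
      }
      where
      unreached = ¬All⇒Any¬ (λ v → (w y + v) % p ∈? U′) U ¬closed
      v = Any.lookup unreached
      found : Attains P v × ¬ (w y + v) % p ∈ U′
      found = All.lookupAny attained unreached

  sumset : ∀ P → Distinct residue P → suc (length P) ≤ p → SumSet P
  sumset [] [] _ = sumset-[]
  sumset ((x , y) ∷ P) (x≢y ∷ distinct) bound = sumset-∷ x≢y bound (sumset P distinct (<⇒≤ bound))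

  sum-constant-residue : ∀ {c} W → All (λ x → residue x ≡ c % p) W → sum (map w W) % p ≡ (length W * c) % p
  sum-constant-residue [] [] = refl
  sum-constant-residue {c} (x ∷ W) (x≡c ∷ W≡c) =
    trans (%-congˡ-+ p _ x≡c) (%-congʳ-+ p c (sum-constant-residue W W≡c))

  window-∣ : ∀ {f} W → All (λ x → residue x ≡ residue f) W → length W ≡ p → p ∣ sum (map w W)
  window-∣ {f} W constant |W|≡p = m%n≡0⇒n∣m _ p (begin
    sum (map w W) % p       ≡⟨ sum-constant-residue W constant ⟩
    (length W * w f) % p    ≡⟨ cong (λ n → (n * w f) % p) |W|≡p ⟩
    (p * w f) % p           ≡⟨ cong (_% p) (*-comm p (w f)) ⟩
    (w f * p) % p           ≡⟨ m*n%n≡0 (w f) p ⟩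
    0                       ∎)
    where open ≡-Reasoning

  pairs-zero-sum : ∀ P z → Distinct residue P → suc (length P) ≡ p →
    ∃₂ λ T N → z ∷ flatten P ↭ T ++ N × length T ≡ p × p ∣ sum (map w T)
  pairs-zero-sum P z distinct |P|+1≡p =
    z ∷ chosen , rest , prep z split , trans (cong suc length-chosen) |P|+1≡p , m%n≡0⇒n∣m _ p (begin
      (w z + sum (map w chosen)) % p         ≡⟨ %-congʳ-+ p (w z) residue-sum ⟩
      (w z + (p ∸ residue z)) % p            ≡⟨ %-congˡ-+ p {residue z} {w z} _ (m%n%n≡m%n (w z) p) ⟨
      (residue z + (p ∸ residue z)) % p      ≡⟨ cong (_% p) (m+[n∸m]≡n (<⇒≤ (m%n<n (w z) p))) ⟩
      p % p                                  ≡⟨ n%n≡0 p ⟩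
      0                                      ∎)
    where
    open ≡-Reasoning
    open SumSet (sumset P distinct (≤-reflexive |P|+1≡p))
    open Attains (All.lookup attained (residues-complete p unique bounded
      (subst (_≤ length residues) |P|+1≡p large) (m%n<n (p ∸ residue z) p)))

ErdősGinzburgZiv-prime : ∀ {p} → Prime p → ErdősGinzburgZiv p
ErdősGinzburgZiv-prime {zero} p-prime = contradiction refl (≢-nonZero⁻¹ 0 {{prime⇒nonZero p-prime}})
ErdősGinzburgZiv-prime {suc q} p-prime w L (s≤s bound) with window-or-pairs (residue p-prime w) q L bound
... | window f W R L↭W++R |W|≡p constant = W , R , L↭W++R , |W|≡p , window-∣ p-prime w W constant |W|≡p
... | pairs P z R L↭P++z∷R |P|≡q distinct with pairs-zero-sum p-prime w P z distinct (cong suc |P|≡q)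
...   | T , N , z∷P↭T++N , |T|≡p , p∣ΣT = T , N ++ R , L↭T++N++R , |T|≡p , p∣ΣT
  where
  L↭T++N++R : L ↭ T ++ N ++ R
  L↭T++N++R = ↭-trans L↭P++z∷R (↭-trans (shift z (flatten P) R)
    (↭-trans (++⁺ʳ R z∷P↭T++N) (↭-reflexive (++-assoc T N R))))

ErdősGinzburgZiv-product : ∀ {ps} → All Prime ps → ErdősGinzburgZiv (product ps)
ErdősGinzburgZiv-product [] = ErdősGinzburgZiv-1
ErdősGinzburgZiv-product (p-prime ∷ ps-prime) =
  ErdősGinzburgZiv-* (ErdősGinzburgZiv-prime p-prime) (ErdősGinzburgZiv-product ps-prime)
    {{productOfPrimes≢0 ps-prime}}

erdős-ginzburg-ziv : ∀ n .{{_ : NonZero n}} → ErdősGinzburgZiv n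
erdős-ginzburg-ziv n = subst ErdősGinzburgZiv (sym isFactorisation) (ErdősGinzburgZiv-product factorsPrime)
  where open PrimeFactorisation (factorise n)

lookup-strictlyIncreasing : ∀ {xs : List ℕ} → AllPairs _<_ xs → StrictlyIncreasing (lookup xs)
lookup-strictlyIncreasing (x<xs ∷ _) Fin.zero (Fin.suc j) _ = All.lookup x<xs (∈-lookup j)
lookup-strictlyIncreasing (_ ∷ xs<) (Fin.suc i) (Fin.suc j) (s≤s i<j) = lookup-strictlyIncreasing xs< i j i<j

module _ {k : ℕ} {S : Fin (suc k) → ℕ} (S< : StrictlyIncreasing S) where

  first+k≤last : S Fin.zero + k ≤ S (Fin.fromℕ k)
  first+k≤last = go k S S<
    where
    go : ∀ k (S : Fin (suc k) → ℕ) → StrictlyIncreasing S → S Fin.zero + k ≤ S (Fin.fromℕ k)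
    go zero S _ = ≤-reflexive (+-identityʳ _)
    go (suc k) S S< = begin
      S Fin.zero + suc k          ≡⟨ +-suc _ k ⟩
      suc (S Fin.zero + k)        ≤⟨ +-monoˡ-≤ k (S< Fin.zero (Fin.suc Fin.zero) (s≤s z≤n)) ⟩
      S (Fin.suc Fin.zero) + k    ≤⟨ go k (S ∘ Fin.suc) (λ i j i<j → S< (Fin.suc i) (Fin.suc j) (s≤s i<j)) ⟩
      S (Fin.suc (Fin.fromℕ k))   ∎
      where open ≤-Reasoning

  monotone : ∀ {i j} → i Fin.≤ j → S i ≤ S j
  monotone {i} {j} i≤j with i Fin.≟ j
  ... | yes refl = ≤-refl
  ... | no i≢j = <⇒≤ (S< i j (Fin.≤∧≢⇒< i≤j i≢j))

  cannot-fit : ∀ {a} → (∀ i → a ≤ S i) → (∀ i → S i < a + k) → ⊥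
  cannot-fit a≤S S<a+k = <⇒≱ (S<a+k (Fin.fromℕ k)) (≤-trans (+-monoˡ-≤ k (a≤S Fin.zero)) first+k≤last)

sorted-rearrangement : ∀ {L T R : List ℕ} → AllPairs _<_ L → L ↭ T ++ R →
  ∃[ T′ ] T′ ↭ T × AllPairs _<_ T′
sorted-rearrangement {L} {T} L< L↭T++R = sort T , sort-↭ T ,
  AllPairs.zipWith (λ (x≤y , x≢y) → ≤∧≢⇒< x≤y x≢y)
    (Sorted.Sorted⇒AllPairs ≤-totalOrder (sort-↗ T) , sort-T-unique)
  where
  open import Data.List.Sort ≤-decTotalOrder using (sort; sort-↭; sort-↗)
  sort-T-unique : Unique (sort T)
  sort-T-unique = Permutationₛ.Unique-resp-↭ (setoid ℕ) (↭⇒↭ₛ (↭-sym (sort-↭ T)))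
    (AllPairs-++⁻ˡ T (Permutationₛ.Unique-resp-↭ (setoid ℕ) (↭⇒↭ₛ L↭T++R) (AllPairs.map <⇒≢ L<)))

-- Good subsets of an interval

sumFin-lookup-residues : ∀ k .{{_ : NonZero k}} (f : ℕ → ℤ) (T : List ℕ) →
  sumFin (λ i → f (lookup T i)) ≡
    + sum (map (λ x → f x %ℕ k) T) ℤ.+ sumFin (λ i → f (lookup T i) /ℕ k) ℤ.* + k
sumFin-lookup-residues k f [] = refl
sumFin-lookup-residues k f (x ∷ T) = begin
  f x ℤ.+ sumFin (λ i → f (lookup T i))
    ≡⟨ cong₂ ℤ._+_ (a≡a%ℕn+[a/ℕn]*n (f x) k) (sumFin-lookup-residues k f T) ⟩
  (+ (f x %ℕ k) ℤ.+ f x /ℕ k ℤ.* + k) ℤ.+ (+ S ℤ.+ Q ℤ.* + k)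
    ≡⟨ regroup (+ (f x %ℕ k)) (f x /ℕ k) (+ S) Q (+ k) ⟩
  (+ (f x %ℕ k) ℤ.+ + S) ℤ.+ (f x /ℕ k ℤ.+ Q) ℤ.* + k
    ≡⟨ cong (ℤ._+ (f x /ℕ k ℤ.+ Q) ℤ.* + k) (ℤ.pos-+ (f x %ℕ k) S) ⟨
  + (f x %ℕ k + S) ℤ.+ (f x /ℕ k ℤ.+ Q) ℤ.* + k ∎
  where
  open ≡-Reasoning
  S = sum (map (λ x → f x %ℕ k) T)
  Q = sumFin (λ i → f (lookup T i) /ℕ k)
  regroup : ∀ r q s Q k → (r ℤ.+ q ℤ.* k) ℤ.+ (s ℤ.+ Q ℤ.* k) ≡ (r ℤ.+ s) ℤ.+ (q ℤ.+ Q) ℤ.* k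
  regroup = ℤ-Solver.solve-∀

residues-∣⇒∣ : ∀ k .{{_ : NonZero k}} (f : ℕ → ℤ) (T : List ℕ) →
  k ∣ sum (map (λ x → f x %ℕ k) T) → + k ℤ.∣ sumFin (λ i → f (lookup T i))
residues-∣⇒∣ k f T k∣S = ℤˢ.∣⇒∣ᵤ (subst (+ k ℤˢ.∣_) (sym (sumFin-lookup-residues k f T))
  (ℤˢ.∣m∣n⇒∣m+n (ℤˢ.∣ᵤ⇒∣ {i = + sum (map (λ x → f x %ℕ k) T)} k∣S)
                 (ℤˢ.∣n⇒∣m*n (sumFin (λ i → f (lookup T i) /ℕ k)) ℤˢ.∣-refl)))

module _ (Δ : Coloring) where

  -- Junk value 0 at ∞; it is only used where Δ x ≡ just (value x).
  value : ℕ → ℤ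
  value x = fromMaybe (+ 0) (Δ x)

  ∞? : Decidable (λ x → Δ x ≡ nothing)
  ∞? x = Maybe.≡-dec ℤ._≟_ (Δ x) nothing

  ≢∞⇒≡just : ∀ {x} → Δ x ≢ nothing → Δ x ≡ just (value x)
  ≢∞⇒≡just {x} Δx≢∞ with Δ x
  ... | nothing = contradiction refl Δx≢∞
  ... | just c = refl

  tuple-from-list : ∀ {k} {P : ℕ → Set} (T : List ℕ) → length T ≡ k → AllPairs _<_ T → All P T →
    Good Δ (lookup T) →
    ∃[ S ] StrictlyIncreasing {k} S × (∀ i → P (S i)) × Good Δ S
  tuple-from-list T refl T< T-P good =
    lookup T , lookup-strictlyIncreasing T< , (λ i → All.lookup T-P (∈-lookup i)) , good

  zero-sum-subsequence : ∀ m {P : ℕ → Set} (L : List ℕ) → AllPairs _<_ L → All P L →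
    All (λ x → Δ x ≡ just (value x)) L → suc m + suc m ≤ suc (length L) →
    ∃[ S ] StrictlyIncreasing {suc m} S × (∀ i → P (S i)) × Good Δ S
  zero-sum-subsequence m L L< L-P L-ℤ |L|≥
    with erdős-ginzburg-ziv (suc m) (λ x → value x %ℕ suc m) L |L|≥
  ... | T₀ , R , L↭T₀++R , |T₀|≡ , m∣ΣT₀ with sorted-rearrangement L< L↭T₀++R
  ... | T , T↭T₀ , T< = tuple-from-list T |T|≡ T< (inherit L-P)
    (inj₂ ((λ i → value (lookup T i)) , (λ i → All.lookup (inherit L-ℤ) (∈-lookup i)) , m∣ΣT))
    where
    inherit : ∀ {Q : ℕ → Set} → All Q L → All Q T
    inherit L-Q = All-resp-↭ (↭-sym T↭T₀) (All.++⁻ˡ T₀ (All-resp-↭ L↭T₀++R L-Q))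
    |T|≡ : length T ≡ suc m
    |T|≡ = trans (↭-length T↭T₀) |T₀|≡
    m∣ΣT : + length T ℤ.∣ sumFin (λ i → value (lookup T i))
    m∣ΣT = subst (λ k → + k ℤ.∣ sumFin (λ i → value (lookup T i))) (sym |T|≡)
      (residues-∣⇒∣ (suc m) value T (subst (suc m ∣_) (sym (sum-↭ (map⁺ _ T↭T₀))) m∣ΣT₀))

  good-subsequence : ∀ m {P : ℕ → Set} (L : List ℕ) → AllPairs _<_ L → All P L →
    suc (m + m + m) ≤ length L →
    ∃[ S ] StrictlyIncreasing {suc m} S × (∀ i → P (S i)) × Good Δ S
  good-subsequence m L L< L-P |L|≥ with suc m ≤? length (filter ∞? L)
  ... | yes m<|L∞| = tuple-from-list (take (suc m) (filter ∞? L))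
    (trans (length-take (suc m) (filter ∞? L)) (m≤n⇒m⊓n≡m m<|L∞|))
    (AllPairs.take⁺ (suc m) (AllPairs.filter⁺ ∞? L<)) (All.take⁺ (suc m) (All.filter⁺ ∞? L-P))
    (inj₁ (λ i → All.lookup (All.take⁺ (suc m) (All.all-filter ∞? L)) (∈-lookup i)))
  ... | no m≮|L∞| = zero-sum-subsequence m (filter (¬? ∘ ∞?) L)
    (AllPairs.filter⁺ _ L<) (All.filter⁺ _ L-P) (All.map ≢∞⇒≡just (All.all-filter (¬? ∘ ∞?) L)) |Lℤ|≥
    where
    |Lℤ|≥ : suc m + suc m ≤ suc (length (filter (¬? ∘ ∞?) L))
    |Lℤ|≥ = s≤s (+-cancelˡ-≤ m _ _ (begin
      m + (m + suc m)                                        ≡⟨ three-m m ⟩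
      suc (m + m + m)                                        ≤⟨ |L|≥ ⟩
      length L                                               ≡⟨ length-filter-¬ ∞? L ⟨
      length (filter ∞? L) + length (filter (¬? ∘ ∞?) L)    ≤⟨ +-monoˡ-≤ _ (≤-pred (≰⇒> m≮|L∞|)) ⟩
      m + length (filter (¬? ∘ ∞?) L)                        ∎))
      where
      open ≤-Reasoning
      three-m : ∀ m → m + (m + suc m) ≡ suc (m + m + m)
      three-m = solve-∀

good-in-interval : ∀ Δ m lo →
  ∃[ S ] StrictlyIncreasing {suc m} S × (∀ i → lo ≤ S i × S i ≤ lo + (m + m + m)) × Good Δ S
good-in-interval Δ m lo = good-subsequence Δ m {λ x → lo ≤ x × x ≤ lo + (m + m + m)} interval
  (AllPairs.applyUpTo⁺₁ _ _ (λ i<j _ → +-monoʳ-< lo i<j))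
  (All.applyUpTo⁺₁ _ _ (λ {i} i<1+3m → m≤m+n lo i , +-monoʳ-≤ lo (≤-pred i<1+3m)))
  (≤-reflexive (sym (length-applyUpTo (λ i → lo + i) (suc (m + m + m)))))
  where
  interval : List ℕ
  interval = applyUpTo (λ i → lo + i) (suc (m + m + m))

-- The extremal colouring

sumFin-01 : ∀ {k} (c : Fin k → ℤ) → (∀ i → c i ≡ + 0 ⊎ c i ≡ + 1) →
  ∃[ K ] sumFin c ≡ + K × K ≤ k × (K ≡ 0 → ∀ i → c i ≡ + 0) × (K ≡ k → ∀ i → c i ≡ + 1)
sumFin-01 {zero} c _ = 0 , refl , z≤n , (λ _ ()) , (λ _ ())
sumFin-01 {suc k} c c01 with sumFin-01 (c ∘ Fin.suc) (c01 ∘ Fin.suc) | c01 Fin.zero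
... | K , Σ≡ , K≤k , all-0 , _ | inj₁ c₀≡0 =
  K , trans (cong₂ ℤ._+_ c₀≡0 Σ≡) (ℤ.+-identityˡ (+ K)) , m≤n⇒m≤1+n K≤k ,
  (λ { K≡0 Fin.zero → c₀≡0 ; K≡0 (Fin.suc i) → all-0 K≡0 i }) ,
  (λ K≡1+k → contradiction (subst (_≤ k) K≡1+k K≤k) (<⇒≱ ≤-refl))
... | K , Σ≡ , K≤k , _ , all-1 | inj₂ c₀≡1 =
  suc K , cong₂ ℤ._+_ c₀≡1 Σ≡ , s≤s K≤k , (λ ()) ,
  (λ { K≡k Fin.zero → c₀≡1 ; K≡k (Fin.suc i) → all-1 (suc-injective K≡k) i })

zero-sum-01 : ∀ {k} (c : Fin (suc k) → ℤ) → (∀ i → c i ≡ + 0 ⊎ c i ≡ + 1) → + suc k ℤ.∣ sumFin c →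
  (∀ i → c i ≡ + 0) ⊎ (∀ i → c i ≡ + 1)
zero-sum-01 {k} c c01 k∣Σ with sumFin-01 c c01
... | zero , _ , _ , all-0 , _ = inj₁ (all-0 refl)
... | suc K , Σ≡ , K≤k , _ , all-1 =
  inj₂ (all-1 (≤-antisym K≤k (∣⇒≤ (subst (λ z → suc k ∣ ℤ.∣ z ∣) Σ≡ k∣Σ))))

blocks : ℕ → ℕ → ℕ → Color
blocks k o x with x <? o + k | x <? o + k + k
... | yes _ | _     = nothing
... | no _  | yes _ = just (+ 0)
... | no _  | no _  = just (+ 1)

module _ {k o x : ℕ} where

  blocks-∞ : blocks k o x ≡ nothing → x < o + k
  blocks-∞ with x <? o + k | x <? o + k + k
  ... | yes x<o+k | _ = λ _ → x<o+k
  ... | no _ | yes _ = λ ()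
  ... | no _ | no _ = λ ()

  blocks-0 : blocks k o x ≡ just (+ 0) → o + k ≤ x × x < o + k + k
  blocks-0 with x <? o + k | x <? o + k + k
  ... | yes _ | _ = λ ()
  ... | no x≮o+k | yes x<o+2k = λ _ → ≮⇒≥ x≮o+k , x<o+2k
  ... | no _ | no _ = λ ()

  blocks-1 : blocks k o x ≡ just (+ 1) → o + k + k ≤ x
  blocks-1 with x <? o + k | x <? o + k + k
  ... | yes _ | _ = λ ()
  ... | no _ | yes _ = λ ()
  ... | no _ | no x≮o+2k = λ _ → ≮⇒≥ x≮o+2k

  blocks-01 : ∀ {c} → blocks k o x ≡ just c → c ≡ + 0 ⊎ c ≡ + 1
  blocks-01 with x <? o + k | x <? o + k + k
  ... | yes _ | _ = λ ()
  ... | no _ | yes _ = λ { refl → inj₁ refl }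
  ... | no _ | no _ = λ { refl → inj₂ refl }

no-good-in-blocks : ∀ {Δ k} o (S : Fin (suc k) → ℕ) → StrictlyIncreasing S →
  (∀ i → o ≤ S i) → (∀ i → S i < o + k + k + k) → (∀ i → Δ (S i) ≡ blocks k o (S i)) → ¬ Good Δ S
no-good-in-blocks o S S< o≤S S<o+3k Δ≡ (inj₁ all-∞) =
  cannot-fit S< o≤S (λ i → blocks-∞ (trans (sym (Δ≡ i)) (all-∞ i)))
no-good-in-blocks o S S< o≤S S<o+3k Δ≡ (inj₂ (c , Δ≡c , k∣Σc))
  with zero-sum-01 c (λ i → blocks-01 (trans (sym (Δ≡ i)) (Δ≡c i))) k∣Σc
... | inj₁ all-0 = cannot-fit S< (λ i → proj₁ (in-0-block i)) (λ i → proj₂ (in-0-block i))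
  where in-0-block = λ i → blocks-0 (trans (sym (Δ≡ i)) (trans (Δ≡c i) (cong just (all-0 i))))
... | inj₂ all-1 =
  cannot-fit S< (λ i → blocks-1 (trans (sym (Δ≡ i)) (trans (Δ≡c i) (cong just (all-1 i))))) S<o+3k

-- The paper colours 3a + 1 with ∞; any colour works, as lower-bound only inspects
-- [1, 3a] and [3a + 2, 3a + 3b + 1].
lower-colouring : ℕ → ℕ → Coloring
lower-colouring a b x with x ≤? suc (a + a + a)
... | yes _ = blocks a 1 x
... | no _ = blocks b (suc (suc (a + a + a))) x

module _ {a b x : ℕ} where

  lower-colouring-≤ : x ≤ suc (a + a + a) → lower-colouring a b x ≡ blocks a 1 x
  lower-colouring-≤ x≤ with x ≤? suc (a + a + a)
  ... | yes _ = refl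
  ... | no x≰ = contradiction x≤ x≰

  lower-colouring-> : suc (a + a + a) < x → lower-colouring a b x ≡ blocks b (suc (suc (a + a + a))) x
  lower-colouring-> x> with x ≤? suc (a + a + a)
  ... | yes x≤ = contradiction x≤ (<⇒≱ x>)
  ... | no _ = refl

lower-bound : ∀ a b n → n < suc (suc (a + a + a + (b + b + b))) → ¬ Property (suc a) (suc b) n
lower-bound a b n n<N P with P (lower-colouring a b)
... | S₁ , S₂ , S₁< , S₁-range , S₁-good , S₂< , S₂-range , S₂-good , last₁<first₂ , _
  with S₂ Fin.zero ≤? suc (a + a + a)
... | yes first₂≤ = no-good-in-blocks {lower-colouring a b} 1 S₁ S₁< (proj₁ ∘ S₁-range) S₁<first₂
  (λ i → lower-colouring-≤ {a} {b} (<⇒≤ (S₁<first₂ i))) S₁-good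
  where
  S₁<first₂ : ∀ i → S₁ i < suc (a + a + a)
  S₁<first₂ i = <-≤-trans (≤-<-trans (monotone S₁< (Fin.≤fromℕ i)) last₁<first₂) first₂≤
... | no first₂≰ = no-good-in-blocks {lower-colouring a b} (suc (suc (a + a + a))) S₂ S₂< first₂<S₂ S₂<N
  (λ i → lower-colouring-> {a} {b} (first₂<S₂ i)) S₂-good
  where
  first₂<S₂ : ∀ i → suc (suc (a + a + a)) ≤ S₂ i
  first₂<S₂ i = ≤-trans (≰⇒> first₂≰) (monotone S₂< {j = i} z≤n)
  S₂<N : ∀ i → S₂ i < suc (suc (a + a + a)) + b + b + b
  S₂<N i = <-≤-trans (≤-<-trans (proj₂ (S₂-range i)) n<N) (≤-reflexive (regroup a b))
    where
    regroup : ∀ a b → suc (suc (a + a + a + (b + b + b))) ≡ suc (suc (a + a + a)) + b + b + b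
    regroup = solve-∀

upper-bound : ∀ a b → a + a + a ≤ b → Property (suc a) (suc b) (suc (suc (a + a + a + (b + b + b))))
upper-bound a b 3a≤b Δ with good-in-interval Δ a 1 | good-in-interval Δ b (suc (suc (a + a + a)))
... | S₁ , S₁< , S₁-range , S₁-good | S₂ , S₂< , S₂-range , S₂-good =
  S₁ , S₂ , S₁< , S₁-in-range , S₁-good , S₂< , S₂-in-range , S₂-good , last₁<first₂ , diam₁≤diam₂
  where
  S₁-in-range : InRange (suc (suc (a + a + a + (b + b + b)))) S₁
  S₁-in-range i = proj₁ (S₁-range i) , ≤-trans (proj₂ (S₁-range i)) (≤-trans (s≤s (m≤m+n _ _)) (n≤1+n _))
  S₂-in-range : InRange (suc (suc (a + a + a + (b + b + b)))) S₂
  S₂-in-range i = ≤-trans (s≤s z≤n) (proj₁ (S₂-range i)) , proj₂ (S₂-range i)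
  last₁<first₂ : S₁ (Fin.fromℕ a) < S₂ Fin.zero
  last₁<first₂ = ≤-trans (s≤s (proj₂ (S₁-range (Fin.fromℕ a)))) (proj₁ (S₂-range Fin.zero))
  diam₁≤diam₂ : S₁ (Fin.fromℕ a) ∸ S₁ Fin.zero ≤ S₂ (Fin.fromℕ b) ∸ S₂ Fin.zero
  diam₁≤diam₂ = begin
    S₁ (Fin.fromℕ a) ∸ S₁ Fin.zero     ≤⟨ ∸-mono (proj₂ (S₁-range (Fin.fromℕ a))) (proj₁ (S₁-range Fin.zero)) ⟩
    a + a + a                          ≤⟨ 3a≤b ⟩
    b                                  ≤⟨ m+n≤o⇒m≤o∸n b (subst (_≤ S₂ (Fin.fromℕ b)) (+-comm (S₂ Fin.zero) b)
                                                         (first+k≤last S₂<)) ⟩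
    S₂ (Fin.fromℕ b) ∸ S₂ Fin.zero     ∎
    where open ≤-Reasoning

theorem4p10 : ∀ (s r : ℕ) → 2 ≤ s → s ≤ r → 3 * s ∸ 3 < r →
    IsF s r (3 * s + 3 * r ∸ 4)
theorem4p10 zero _ () _ _
theorem4p10 (suc a) zero _ () _
theorem4p10 (suc a) (suc b) _ _ 3s-3<r = subst (IsF (suc a) (suc b)) (sym (N≡ a b))
  (s≤s z≤n , upper-bound a b 3a≤b , λ n _ n<N → lower-bound a b n n<N)
  where
  N≡ : ∀ a b → 3 * suc a + 3 * suc b ∸ 4 ≡ suc (suc (a + a + a + (b + b + b)))
  N≡ a b = trans (cong (_∸ 4) (expand a b)) (m+n∸m≡n 4 _)
    where
    expand : ∀ a b → 3 * suc a + 3 * suc b ≡ 4 + suc (suc (a + a + a + (b + b + b)))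
    expand = solve-∀
  3a≤b : a + a + a ≤ b
  3a≤b = ≤-pred (subst (_< suc b) (trans (cong (_∸ 3) (expand a)) (m+n∸m≡n 3 _)) 3s-3<r)
    where
    expand : ∀ a → 3 * suc a ≡ 3 + (a + a + a)
    expand = solve-∀
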